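{- Let $n\ge3$, $1\le i\le n-2$, $a_i,a_{i+1}$ positive integers, and let $A_i\subset Q_i$ and $A_{i+1}\subset Q_{i+1}$ be $\preceq$-antichains. Then $v=a_i\chi_{A_i}+a_{i+1}\chi_{A_{i+1}}$ is a vertex of $P_{a_i\omega_i+a_{i+1}\omega_{i+1}}$ if and only if every $(k,l)\in A_i\cup A_{i+1}$ lies in $A_i\cap A_{i+1}$ or in $\Delta$.
   Context: $U=\mathbb R^{\binom n2}$ with coordinates $x_{k,l}$, $1\le k<l\le n$. A Dyck path is a sequence $d=((i_1,j_1),\ldots,(i_N,j_N))$ of pairs with $1\le i_k<j_k\le n$, $j_1-i_1=j_N-i_N=1$, and each $(i_{k+1},j_{k+1})$ equal to $(i_k+1,j_k)$ or $(i_k,j_k+1)$. For $\mu=\sum b_m\omega_m$ ($b_m\ge0$ integers) let $M(\mu,d)=b_{i_1}+b_{i_1+1}+\ldots+b_{i_N}$ and $P_\mu=\{x\in U:x\ge0,\ \sum_{(k,l)\in d}x_{k,l}\le M(\mu,d)\ \forall d\}$. Pairs are ordered by $(k_1,l_1)\preceq(k_2,l_2)$ iff $k_1\le k_2$, $l_1\le l_2$. $Q_m=\{(k,l):1\le k\le m,\ m+1\le l\le n\}$; $\chi_A$ is the indicator function of $A$. Let $\Gamma$ be the graph with node set $A_i\cup A_{i+1}$ in which two nodes are adjacent iff they are distinct and $\preceq$-comparable. If all nodes of $\Gamma$ lie in $Q_i\cap Q_{i+1}$, set $\Delta=\varnothing$; otherwise all nodes of $\Gamma$ outside $Q_i\cap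 Q_{i+1}$ lie in one connected component of $\Gamma$, and $\Delta$ is the node set of that component.
   Formalization: Points of U, including the points of $P_\mu$ against which v is tested for being a vertex, have rational coordinates instead of real ones. -}

module Defs where

open import Data.Nat as ℕ using (ℕ; zero; suc; _∸_)
open import Data.Bool using (Bool; true; false; if_then_else_)
open import Data.Product using (Σ; ∃; _×_; _,_; proj₁; proj₂)
open import Data.Sum using (_⊎_)
open import Data.List using (List; []; _∷_; map; foldr; upTo)
open import Data.List.NonEmpty using (List⁺; toList; last) renaming (head to head⁺)
open import Data.List.Relation.Unary.Linked using (Linked)
open import Data.List.Relation.Unary.All using (All)
open import Data.Integer using (+_)
open import Data.Rational as ℚ using (ℚ; 0ℚ; 1ℚ; _/_)
open import Relation.Binary.PropositionalEquality using (_≡_; _≢_)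
open import Relation.Nullary using (yes; no)
open import Data.Empty using (⊥)
open import Relation.Binary.Construct.Closure.ReflexiveTransitive using (Star)

-- Indices are 1-based natural numbers, as in the paper.
Pair : Set
Pair = ℕ × ℕ

-- (k,l) is a coordinate of U = ℝ^(n choose 2):  1 ≤ k < l ≤ n
ValidPair : ℕ → Pair → Set
ValidPair n (k , l) = (1 ℕ.≤ k) × (k ℕ.< l) × (l ℕ.≤ n)

-- Points of U (with rational coordinates); only coordinates at valid pairs matter.
Point : Set
Point = ℕ → ℕ → ℚ

ℕ→ℚ : ℕ → ℚ
ℕ→ℚ m = + m / 1

Step : Pair → Pair → Set
Step (i , j) (i' , j') = ((i' ≡ suc i) × (j' ≡ j)) ⊎ ((i' ≡ i) × (j' ≡ suc j))

IsDyckPath : ℕ → List⁺ Pair → Set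
IsDyckPath n d =
  All (ValidPair n) (toList d)
  × (proj₂ (head⁺ d) ≡ suc (proj₁ (head⁺ d)))
  × (proj₂ (last d) ≡ suc (proj₁ (last d)))
  × Linked Step (toList d)

-- Σ_{m = s}^{e} b m   (used only with s ≤ e)
rangeSum : (ℕ → ℕ) → ℕ → ℕ → ℕ
rangeSum b s e = foldr ℕ._+_ 0 (map (λ t → b (s ℕ.+ t)) (upTo (suc (e ∸ s))))

-- M(μ,d) = b_{i₁} + b_{i₁+1} + … + b_{i_N},  μ = Σ b_m ω_m given by b
M : (ℕ → ℕ) → List⁺ Pair → ℕ
M b d = rangeSum b (proj₁ (head⁺ d)) (proj₁ (last d))

pathSum : Point → List⁺ Pair → ℚ
pathSum x d = foldr ℚ._+_ 0ℚ (map (λ p → x (proj₁ p) (proj₂ p)) (toList d))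

InP : ℕ → (ℕ → ℕ) → Point → Set
InP n b x =
  (∀ k l → ValidPair n (k , l) → 0ℚ ℚ.≤ x k l)
  × (∀ d → IsDyckPath n d → pathSum x d ℚ.≤ ℕ→ℚ (M b d))

_≈U_ : Point → Point → ℕ → Set
(x ≈U y) n = ∀ k l → ValidPair n (k , l) → x k l ≡ y k l

IsVertex : ℕ → (ℕ → ℕ) → Point → Set
IsVertex n b v =
  InP n b v
  × (∀ y z t → InP n b y → InP n b z → 0ℚ ℚ.< t → t ℚ.< 1ℚ
       → (v ≈U (λ k l → t ℚ.* y k l ℚ.+ (1ℚ ℚ.- t) ℚ.* z k l)) n
       → (y ≈U z) n)

-- μ = a_i ω_i + a_{i+1} ω_{i+1}, as its coefficient function m ↦ b_m
twoWeight : ℕ → ℕ → ℕ → ℕ → ℕ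
twoWeight i ai ai1 m with m ℕ.≟ i | m ℕ.≟ suc i
... | yes _ | _ = ai
... | no _ | yes _ = ai1
... | no _ | no _ = 0

Subset : Set
Subset = ℕ → ℕ → Bool

_∈S_ : Pair → Subset → Set
(k , l) ∈S A = A k l ≡ true

χ : Subset → ℕ → ℕ → ℚ
χ A k l = if A k l then 1ℚ else 0ℚ

_≼_ : Pair → Pair → Set
(k₁ , l₁) ≼ (k₂ , l₂) = (k₁ ℕ.≤ k₂) × (l₁ ℕ.≤ l₂)

InQ : ℕ → ℕ → Pair → Set
InQ n m (k , l) = (1 ℕ.≤ k) × (k ℕ.≤ m) × (suc m ℕ.≤ l) × (l ℕ.≤ n)

SubsetOfQ : ℕ → ℕ → Subset → Set
SubsetOfQ n m A = ∀ p → p ∈S A → InQ n m p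

IsAntichain : Subset → Set
IsAntichain A = ∀ p q → p ∈S A → q ∈S A → p ≼ q → p ≡ q

Node : Subset → Subset → Pair → Set
Node A B p = (p ∈S A) ⊎ (p ∈S B)

Adj : Subset → Subset → Pair → Pair → Set
Adj A B p q = Node A B p × Node A B q × (p ≢ q) × ((p ≼ q) ⊎ (q ≼ p))

-- p ∈ Δ: p lies in the connected component of Γ containing the nodes of Γ
-- outside Q_i ∩ Q_{i+1}  (Δ = ∅ if there are no such nodes).
InΔ : ℕ → ℕ → Subset → Subset → Pair → Set
InΔ n i A B p =
  Σ Pair λ q → Node A B q × (InQ n i q × InQ n (suc i) q → ⊥)
             × Star (Adj A B) p q

{-# OPTIONS --safe #-}
-- Every Dyck path d is a ≼-chain from (i₁,i₁+1) to (i_N,i_N+1), so it meets each antichain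
-- at most once, it passes through a pair of Q_m only if i₁ ≤ m ≤ i_N, and
-- M(μ,d) = a_i·[i₁ ≤ i ≤ i_N] + a_{i+1}·[i₁ ≤ i+1 ≤ i_N]. Hence v ∈ P_μ.
--
-- If every node lies in A_i ∩ A_{i+1} or in Δ, write v = t y + (1-t) z with y, z ∈ P_μ.
-- Then y and z vanish off the nodes and are tight on every path on which v is tight.
-- A hook path through a node of A_i ∩ A_{i+1}, or through a node outside Q_i ∩ Q_{i+1},
-- is tight for v and meets no other node, so it fixes y and z there. A hook through two
-- adjacent nodes of Γ is tight and meets no other node, so it propagates that value
-- along the edges of Γ, and hence to all of Δ.
--
-- Conversely, let S be the set of nodes that are neither in A_i ∩ A_{i+1} nor in Δ.
-- Then y = v + χ_{S ∩ A_i} - χ_{S ∩ A_{i+1}} and z = v - χ_{S ∩ A_i} + χ_{S ∩ A_{i+1}}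
-- stay in P_μ. A path through a node of S ∩ A_i either meets S ∩ A_{i+1} as well (any
-- A_{i+1}-node on it is adjacent to that node), or it meets no A_{i+1}-node and then has
-- slack 1, because S ⊆ Q_i ∩ Q_{i+1} forces M = a_i + a_{i+1}. Since v = (y + z)/2, a
-- vertex v forces S = ∅. Deciding membership in Δ is a breadth-first search in the
-- finite graph Γ.
module Submission where

open import Algebra.Bundles using (CommutativeSemiring; CommutativeRing)
open import Data.Bool as Bool using (true; false; if_then_else_; _∧_; not)
open import Data.Empty using (⊥-elim)
open import Data.Integer as ℤ using (+_)
import Data.Integer.Properties as ℤP
open import Data.List
  using (List; []; _∷_; map; foldr; upTo; filter; length; cartesianProduct; initLast; _∷ʳ′_)
open import Data.List.Membership.Propositional using (_∈_; _∉_; find; lose)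
open import Data.List.Membership.Propositional.Properties
  using (∈-map⁺; ∈-map⁻; ∈-upTo⁺; ∈-upTo⁻; ∈-filter⁺; ∈-filter⁻; ∈-cartesianProduct⁺)
open import Data.List.NonEmpty using (List⁺; _∷_; toList; last) renaming (head to head⁺)
open import Data.List.Properties using (map-∘; filter-notAll)
open import Data.List.Relation.Unary.All as All using (All; []; _∷_)
open import Data.List.Relation.Unary.AllPairs as AllPairs using (AllPairs; []; _∷_)
open import Data.List.Relation.Unary.Any using (here; there; any?)
open import Data.List.Relation.Unary.Linked as Linked using (Linked; []; [-]; _∷_)
open import Data.List.Relation.Unary.Linked.Properties using (Linked⇒AllPairs)
open import Data.List.Relation.Unary.Unique.Propositional using (Unique)
import Data.List.Relation.Unary.Unique.Propositional.Properties as Unique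
open import Data.Nat as ℕ using (ℕ; zero; suc; _≤_; _<_; _∸_; z≤n; s≤s)
open import Data.Nat.Coprimality using (1-coprimeTo) renaming (sym to coprime-sym)
import Data.Nat.Properties as ℕP
open import Data.Product using (∃; _×_; _,_; proj₁; proj₂; uncurry)
open import Data.Product.Properties using (≡-dec)
open import Data.Rational as ℚ using (ℚ; mkℚ; 0ℚ; 1ℚ)
import Data.Rational.Properties as ℚP
open import Data.Sum using (_⊎_; inj₁; inj₂; swap; [_,_]′)
open import Function using (_∘_; _∘₂_; id)
open import Function.Bundles using (_⇔_; mk⇔)
open import Relation.Binary.Construct.Closure.ReflexiveTransitive using (ε; _◅_)
open import Relation.Binary.Definitions using (DecidableEquality)
open import Relation.Binary.PropositionalEquality
  using (_≡_; _≢_; refl; sym; trans; cong; cong₂; subst; subst₂; module ≡-Reasoning)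
open import Relation.Nullary using (¬_; ¬?; Dec; yes; no; does)
open import Relation.Nullary.Decidable using (dec-true; dec-false; _⊎-dec_; _×-dec_)

open import Algebra.Properties.CommutativeSemigroup ℕP.+-commutativeSemigroup
  using () renaming (interchange to ℕ-interchange)
open import Algebra.Properties.Group ℚP.+-0-group using (∙-cancelˡ; ∙-cancelʳ)
open import Data.List.Membership.DecPropositional ℕ._≟_ using () renaming (_∈?_ to _∈ℕ?_)

open import Defs

module SumBy {c ℓ} (R : CommutativeSemiring c ℓ) where
  open CommutativeSemiring R
    using (Carrier; _≈_; _+_; _*_; 0#; setoid; +-cong; +-congˡ; +-congʳ; +-identityʳ; +-identityˡ;
           distribˡ; zeroʳ; +-commutativeSemigroup)
    renaming (refl to ≈-refl; sym to ≈-sym; trans to ≈-trans)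
  open import Relation.Binary.Reasoning.Setoid setoid
  open import Algebra.Properties.CommutativeSemigroup +-commutativeSemigroup using (interchange)

  sumBy : {A : Set} → (A → Carrier) → List A → Carrier
  sumBy f xs = foldr _+_ 0# (map f xs)

  module _ {A : Set} where

    sumBy-cong : ∀ {f g : A → Carrier} {xs} → (∀ {x} → x ∈ xs → f x ≈ g x) → sumBy f xs ≈ sumBy g xs
    sumBy-cong {xs = []}     _   = ≈-refl
    sumBy-cong {xs = x ∷ xs} f≈g = +-cong (f≈g (here refl)) (sumBy-cong (f≈g ∘ there))

    sumBy-+ : ∀ (f g : A → Carrier) xs → sumBy (λ x → f x + g x) xs ≈ sumBy f xs + sumBy g xs
    sumBy-+ f g []       = ≈-sym (+-identityʳ 0#)
    sumBy-+ f g (x ∷ xs) = begin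
      (f x + g x) + sumBy (λ x → f x + g x) xs   ≈⟨ +-congˡ (sumBy-+ f g xs) ⟩
      (f x + g x) + (sumBy f xs + sumBy g xs)     ≈⟨ interchange (f x) (g x) (sumBy f xs) (sumBy g xs) ⟩
      (f x + sumBy f xs) + (g x + sumBy g xs)     ∎

    sumBy-*ˡ : ∀ a (f : A → Carrier) xs → sumBy (λ x → a * f x) xs ≈ a * sumBy f xs
    sumBy-*ˡ a f []       = ≈-sym (zeroʳ a)
    sumBy-*ˡ a f (x ∷ xs) = ≈-trans (+-congˡ (sumBy-*ˡ a f xs)) (≈-sym (distribˡ a (f x) (sumBy f xs)))

    sumBy-zero : ∀ {f : A → Carrier} {xs} → (∀ {x} → x ∈ xs → f x ≈ 0#) → sumBy f xs ≈ 0#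
    sumBy-zero {xs = []}     _   = ≈-refl
    sumBy-zero {xs = x ∷ xs} f≈0 =
      ≈-trans (+-cong (f≈0 (here refl)) (sumBy-zero (f≈0 ∘ there))) (+-identityʳ 0#)

    sumBy-single : ∀ {f : A → Carrier} {xs c} → Unique xs → c ∈ xs →
                   (∀ {x} → x ∈ xs → x ≢ c → f x ≈ 0#) → sumBy f xs ≈ f c
    sumBy-single {f} {x ∷ xs} (x∉xs ∷ _) (here refl) f≈0 =
      ≈-trans (+-congˡ (sumBy-zero λ y∈xs → f≈0 (there y∈xs) λ { refl → All.lookup x∉xs y∈xs refl }))
              (+-identityʳ (f x))
    sumBy-single {f} {x ∷ xs} (x∉xs ∷ uniq) (there c∈xs) f≈0 =
      ≈-trans (+-congʳ (f≈0 (here refl) (All.lookup x∉xs c∈xs)))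
              (≈-trans (+-identityˡ _) (sumBy-single uniq c∈xs (f≈0 ∘ there)))

module ℕΣ = SumBy ℕP.+-*-commutativeSemiring
module ℚΣ = SumBy (CommutativeRing.commutativeSemiring ℚP.+-*-commutativeRing)

sumBy-≥ : ∀ {A : Set} (f : A → ℕ) {xs x} → x ∈ xs → f x ≤ ℕΣ.sumBy f xs
sumBy-≥ f {x ∷ xs} (here refl) = ℕP.m≤m+n (f x) _
sumBy-≥ f {y ∷ xs} (there x∈)  = ℕP.≤-trans (sumBy-≥ f x∈) (ℕP.m≤n+m _ (f y))

sumBy-cancel : ∀ {A : Set} {f g : A → ℚ} {xs p} → Unique xs → p ∈ xs →
               (∀ {x} → x ∈ xs → x ≢ p → f x ≡ g x) → ℚΣ.sumBy f xs ≡ ℚΣ.sumBy g xs → f p ≡ g p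
sumBy-cancel {f = f} {g} {x ∷ xs} (x∉xs ∷ _) (here refl) f≡g eq =
  ∙-cancelʳ (ℚΣ.sumBy g xs) (f x) (g x) (trans (cong (f x ℚ.+_) (sym rest≡)) eq)
  where
  rest≡ : ℚΣ.sumBy f xs ≡ ℚΣ.sumBy g xs
  rest≡ = ℚΣ.sumBy-cong λ y∈xs → f≡g (there y∈xs) λ { refl → All.lookup x∉xs y∈xs refl }
sumBy-cancel {f = f} {g} {x ∷ xs} (x∉xs ∷ uniq) (there p∈xs) f≡g eq =
  sumBy-cancel uniq p∈xs (f≡g ∘ there)
    (∙-cancelˡ (g x) (ℚΣ.sumBy f xs) (ℚΣ.sumBy g xs)
      (trans (cong (ℚ._+ ℚΣ.sumBy f xs) (sym fx≡gx)) eq))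
  where
  fx≡gx : f x ≡ g x
  fx≡gx = f≡g (here refl) (All.lookup x∉xs p∈xs)

ℕ→ℚ≡mkℚ : ∀ m → ℕ→ℚ m ≡ mkℚ (+ m) 0 (coprime-sym (1-coprimeTo m))
ℕ→ℚ≡mkℚ m = ℚP.normalize-coprime (coprime-sym (1-coprimeTo m))

ℕ→ℚ-+ : ∀ a b → ℕ→ℚ (a ℕ.+ b) ≡ ℕ→ℚ a ℚ.+ ℕ→ℚ b
ℕ→ℚ-+ a b rewrite ℕ→ℚ≡mkℚ a | ℕ→ℚ≡mkℚ b =
  cong (ℚ._/ 1) (cong₂ ℤ._+_ (sym (ℤP.*-identityʳ (+ a))) (sym (ℤP.*-identityʳ (+ b))))

ℕ→ℚ-* : ∀ a b → ℕ→ℚ (a ℕ.* b) ≡ ℕ→ℚ a ℚ.* ℕ→ℚ b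
ℕ→ℚ-* a b rewrite ℕ→ℚ≡mkℚ a | ℕ→ℚ≡mkℚ b = cong (ℚ._/ 1) (ℤP.pos-* a b)

ℕ→ℚ-mono-≤ : ∀ {a b} → a ≤ b → ℕ→ℚ a ℚ.≤ ℕ→ℚ b
ℕ→ℚ-mono-≤ {a} {b} a≤b rewrite ℕ→ℚ≡mkℚ a | ℕ→ℚ≡mkℚ b =
  ℚ.*≤* (ℤP.*-monoʳ-≤-nonNeg (+ 1) (ℤ.+≤+ a≤b))

ℕ→ℚ-injective : ∀ {a b} → ℕ→ℚ a ≡ ℕ→ℚ b → a ≡ b
ℕ→ℚ-injective {a} {b} eq =
  ℤP.+-injective (cong ℚ.↥_ (trans (sym (ℕ→ℚ≡mkℚ a)) (trans eq (ℕ→ℚ≡mkℚ b))))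

ℕ→ℚ-sumBy : ∀ {A : Set} (f : A → ℕ) xs → ℕ→ℚ (ℕΣ.sumBy f xs) ≡ ℚΣ.sumBy (ℕ→ℚ ∘ f) xs
ℕ→ℚ-sumBy f []       = refl
ℕ→ℚ-sumBy f (x ∷ xs) =
  trans (ℕ→ℚ-+ (f x) (ℕΣ.sumBy f xs)) (cong (ℕ→ℚ (f x) ℚ.+_) (ℕ→ℚ-sumBy f xs))

ℕ→ℚ-midpoint : ∀ {a b c} → a ℕ.+ b ≡ c ℕ.+ c → ℕ→ℚ c ≡ ℚ.½ ℚ.* ℕ→ℚ a ℚ.+ (1ℚ ℚ.- ℚ.½) ℚ.* ℕ→ℚ b
ℕ→ℚ-midpoint {a} {b} {c} a+b≡c+c = sym (begin
  ℚ.½ ℚ.* ℕ→ℚ a ℚ.+ ℚ.½ ℚ.* ℕ→ℚ b ≡⟨ ℚP.*-distribˡ-+ ℚ.½ (ℕ→ℚ a) (ℕ→ℚ b) ⟨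
  ℚ.½ ℚ.* (ℕ→ℚ a ℚ.+ ℕ→ℚ b)       ≡⟨ cong (ℚ.½ ℚ.*_) (ℕ→ℚ-+ a b) ⟨
  ℚ.½ ℚ.* ℕ→ℚ (a ℕ.+ b)            ≡⟨ cong (λ m → ℚ.½ ℚ.* ℕ→ℚ m) a+b≡c+c ⟩
  ℚ.½ ℚ.* ℕ→ℚ (c ℕ.+ c)            ≡⟨ cong (ℚ.½ ℚ.*_) (ℕ→ℚ-+ c c) ⟩
  ℚ.½ ℚ.* (ℕ→ℚ c ℚ.+ ℕ→ℚ c)       ≡⟨ ℚP.*-distribˡ-+ ℚ.½ (ℕ→ℚ c) (ℕ→ℚ c) ⟩
  ℚ.½ ℚ.* ℕ→ℚ c ℚ.+ ℚ.½ ℚ.* ℕ→ℚ c ≡⟨ ℚP.*-distribʳ-+ (ℕ→ℚ c) ℚ.½ ℚ.½ ⟨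
  1ℚ ℚ.* ℕ→ℚ c                     ≡⟨ ℚP.*-identityˡ (ℕ→ℚ c) ⟩
  ℕ→ℚ c                            ∎)
  where open ≡-Reasoning

module _ {s t : ℚ} (s>0 : ℚ.Positive s) (t>0 : ℚ.Positive t) (s+t≡1 : s ℚ.+ t ≡ 1ℚ) where

  private
    mean-const : ∀ c → s ℚ.* c ℚ.+ t ℚ.* c ≡ c
    mean-const c = trans (sym (ℚP.*-distribʳ-+ c s t)) (trans (cong (ℚ._* c) s+t≡1) (ℚP.*-identityˡ c))

  mean≡upper⇒≡ : ∀ {a b c} → a ℚ.≤ c → b ℚ.≤ c → s ℚ.* a ℚ.+ t ℚ.* b ≡ c → a ≡ c
  mean≡upper⇒≡ {a} {b} {c} a≤c b≤c mean≡c = ℚP.≤-antisym a≤c (ℚP.≮⇒≥ λ a<c → ℚP.<-irrefl refl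
    (subst₂ ℚ._<_ mean≡c (mean-const c)
      (ℚP.+-mono-<-≤ (ℚP.*-monoʳ-<-pos s {{s>0}} a<c)
                     (ℚP.*-monoˡ-≤-nonNeg t {{ℚP.pos⇒nonNeg t {{t>0}}}} b≤c))))

  mean≡lower⇒≡ : ∀ {a b c} → c ℚ.≤ a → c ℚ.≤ b → s ℚ.* a ℚ.+ t ℚ.* b ≡ c → a ≡ c
  mean≡lower⇒≡ {a} {b} {c} c≤a c≤b mean≡c = sym (ℚP.≤-antisym c≤a (ℚP.≮⇒≥ λ c<a → ℚP.<-irrefl refl
    (subst₂ ℚ._<_ (mean-const c) mean≡c
      (ℚP.+-mono-<-≤ (ℚP.*-monoʳ-<-pos s {{s>0}} c<a)
                     (ℚP.*-monoˡ-≤-nonNeg t {{ℚP.pos⇒nonNeg t {{t>0}}}} c≤b)))))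

1-p-positive : ∀ {p} → p ℚ.< 1ℚ → ℚ.Positive (1ℚ ℚ.- p)
1-p-positive {p} p<1 = ℚ.positive (subst (ℚ._< 1ℚ ℚ.- p) (ℚP.+-inverseʳ p) (ℚP.+-monoˡ-< (ℚ.- p) p<1))

p+[1-p]≡1 : ∀ p → p ℚ.+ (1ℚ ℚ.- p) ≡ 1ℚ
p+[1-p]≡1 p =
  trans (ℚP.+-comm p (1ℚ ℚ.- p)) (trans (ℚP.+-assoc 1ℚ (ℚ.- p) p) (cong (1ℚ ℚ.+_) (ℚP.+-inverseˡ p)))

≈U-mean-comm : ∀ {n u s t} {x x′ : Point} → (u ≈U (λ k l → s ℚ.* x k l ℚ.+ t ℚ.* x′ k l)) n →
               (u ≈U (λ k l → t ℚ.* x′ k l ℚ.+ s ℚ.* x k l)) n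
≈U-mean-comm {s = s} {t} {x} {x′} u≡ k l valid =
  trans (u≡ k l valid) (ℚP.+-comm (s ℚ.* x k l) (t ℚ.* x′ k l))

m≡0⇒m≤n : ∀ {m n} → m ≡ 0 → m ≤ n
m≡0⇒m≤n refl = z≤n

shift-≤ : ∀ {y c v a m} → y ℕ.+ c ≡ v ℕ.+ a → a ≤ 1 → v ≤ m → a ≤ c ⊎ v < m → y ≤ m
shift-≤ {y} {c} {v} {a} y+c≡v+a _ v≤m (inj₁ a≤c) =
  ℕP.≤-trans (ℕP.+-cancelʳ-≤ c y v (ℕP.≤-trans (ℕP.≤-reflexive y+c≡v+a) (ℕP.+-monoʳ-≤ v a≤c))) v≤m
shift-≤ {y} {c} {v} {a} y+c≡v+a a≤1 _ (inj₂ v<m) =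
  ℕP.≤-trans (ℕP.m≤m+n y c) (ℕP.≤-trans (ℕP.≤-reflexive y+c≡v+a)
    (ℕP.≤-trans (ℕP.+-monoʳ-≤ v a≤1) (ℕP.≤-trans (ℕP.≤-reflexive (ℕP.+-comm v 1)) v<m)))

shifts-average : ∀ {y z v a b} → y ℕ.+ b ≡ v ℕ.+ a → z ℕ.+ a ≡ v ℕ.+ b → y ℕ.+ z ≡ v ℕ.+ v
shifts-average {y} {z} {v} {a} {b} y+b≡v+a z+a≡v+b =
  ℕP.+-cancelʳ-≡ (a ℕ.+ b) (y ℕ.+ z) (v ℕ.+ v) (begin
  (y ℕ.+ z) ℕ.+ (a ℕ.+ b) ≡⟨ cong ((y ℕ.+ z) ℕ.+_) (ℕP.+-comm a b) ⟩
  (y ℕ.+ z) ℕ.+ (b ℕ.+ a) ≡⟨ ℕ-interchange y z b a ⟩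
  (y ℕ.+ b) ℕ.+ (z ℕ.+ a) ≡⟨ cong₂ ℕ._+_ y+b≡v+a z+a≡v+b ⟩
  (v ℕ.+ a) ℕ.+ (v ℕ.+ b) ≡⟨ ℕ-interchange v a v b ⟩
  (v ℕ.+ v) ℕ.+ (a ℕ.+ b) ∎)
  where open ≡-Reasoning

shifts-differ : ∀ {y z v} → y ℕ.+ 0 ≡ v ℕ.+ 1 → z ℕ.+ 1 ≡ v ℕ.+ 0 → y ≢ z
shifts-differ {y} {z} {v} y≡v+1 z+1≡v refl = ℕP.m≢1+m+n v (begin
  v             ≡⟨ ℕP.+-identityʳ v ⟨
  v ℕ.+ 0       ≡⟨ z+1≡v ⟨
  y ℕ.+ 1       ≡⟨ cong (ℕ._+ 1) (trans (sym (ℕP.+-identityʳ y)) y≡v+1) ⟩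
  v ℕ.+ 1 ℕ.+ 1 ≡⟨ ℕP.+-comm (v ℕ.+ 1) 1 ⟩
  suc (v ℕ.+ 1) ∎)
  where open ≡-Reasoning

-- Breadth-first saturation

module Saturation {V : Set} (_≟_ : DecidableEquality V) {E : V → V → Set} (E? : ∀ x y → Dec (E x y))
                  (P : V → Set) (P-back : ∀ {x y} → E x y → P y → P x) (univ : List V) where

  record Saturated (seeds : List V) : Set where
    field
      members : List V
      sound   : ∀ {x} → x ∈ members → P x
      seeded  : ∀ {x} → x ∈ seeds → x ∈ members
      closed  : ∀ {x y} → x ∈ univ → E x y → y ∈ members → x ∈ members

  private
    remove : V → List V → List V
    remove x = filter (¬? ∘ (_≟ x))

    remove-shrinks : ∀ {x U} → x ∈ U → length (remove x U) < length U
    remove-shrinks {x} {U} x∈U = filter-notAll (¬? ∘ (_≟ x)) U (lose x∈U λ x≢x → x≢x refl)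

    -- W is the visited set, U the unvisited part of univ.
    grow : ∀ fuel W U → length U ≤ fuel → (∀ {x} → x ∈ W → P x) →
           (∀ {x} → x ∈ univ → x ∈ W ⊎ x ∈ U) → Saturated W
    grow fuel W U U≤fuel sound cover with any? (λ x → any? (E? x) W) U
    ... | no stuck = record { members = W ; sound = sound ; seeded = id ; closed = closed }
      where
      closed : ∀ {x y} → x ∈ univ → E x y → y ∈ W → x ∈ W
      closed x∈univ Exy y∈W with cover x∈univ
      ... | inj₁ x∈W = x∈W
      ... | inj₂ x∈U = ⊥-elim (stuck (lose x∈U (lose y∈W Exy)))
    ... | yes found with find found
    ... | x , x∈U , x→W with find x→W
    ... | y , y∈W , Exy with fuel
    ...   | zero      = ⊥-elim (ℕP.n≮0 (ℕP.<-≤-trans (remove-shrinks x∈U) U≤fuel))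
    ...   | suc fuel′ = weaken (grow fuel′ (x ∷ W) (remove x U)
                          (ℕP.≤-pred (ℕP.<-≤-trans (remove-shrinks x∈U) U≤fuel)) sound′ cover′)
      where
      sound′ : ∀ {z} → z ∈ x ∷ W → P z
      sound′ (here refl) = P-back Exy (sound y∈W)
      sound′ (there z∈W) = sound z∈W
      cover′ : ∀ {z} → z ∈ univ → z ∈ x ∷ W ⊎ z ∈ remove x U
      cover′ {z} z∈univ with cover z∈univ | z ≟ x
      ... | inj₁ z∈W | _        = inj₁ (there z∈W)
      ... | inj₂ _   | yes refl = inj₁ (here refl)
      ... | inj₂ z∈U | no z≢x   = inj₂ (∈-filter⁺ (¬? ∘ (_≟ x)) z∈U z≢x)
      weaken : Saturated (x ∷ W) → Saturated W
      weaken sat = record { Saturated sat ; seeded = Saturated.seeded sat ∘ there }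

  saturate : ∀ seeds → (∀ {x} → x ∈ seeds → P x) → Saturated seeds
  saturate seeds sound = grow (length univ) seeds univ ℕP.≤-refl sound inj₂

≼-refl : ∀ {p} → p ≼ p
≼-refl = ℕP.≤-refl , ℕP.≤-refl

≼-trans : ∀ {p q r} → p ≼ q → q ≼ r → p ≼ r
≼-trans (k≤k′ , l≤l′) (k′≤k″ , l′≤l″) = ℕP.≤-trans k≤k′ k′≤k″ , ℕP.≤-trans l≤l′ l′≤l″

≼-antisym : ∀ {p q} → p ≼ q → q ≼ p → p ≡ q
≼-antisym (k≤k′ , l≤l′) (k′≤k , l′≤l) = cong₂ _,_ (ℕP.≤-antisym k≤k′ k′≤k) (ℕP.≤-antisym l≤l′ l′≤l)

_≺_ : Pair → Pair → Set
p ≺ q = p ≼ q × p ≢ q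

≺-trans : ∀ {p q r} → p ≺ q → q ≺ r → p ≺ r
≺-trans (p≼q , p≢q) (q≼r , _) = ≼-trans p≼q q≼r , λ { refl → p≢q (≼-antisym p≼q q≼r) }

Step⇒≺ : ∀ {p q} → Step p q → p ≺ q
Step⇒≺ (inj₁ (refl , refl)) = (ℕP.n≤1+n _ , ℕP.≤-refl) , ℕP.1+n≢n ∘ sym ∘ cong proj₁
Step⇒≺ (inj₂ (refl , refl)) = (ℕP.≤-refl , ℕP.n≤1+n _) , ℕP.1+n≢n ∘ sym ∘ cong proj₂

comparable-antichain : ∀ {C p q} → IsAntichain C → p ∈S C → q ∈S C → p ≼ q ⊎ q ≼ p → p ≡ q
comparable-antichain anti p∈C q∈C (inj₁ p≼q) = anti _ _ p∈C q∈C p≼q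
comparable-antichain anti p∈C q∈C (inj₂ q≼p) = sym (anti _ _ q∈C p∈C q≼p)

Chain : List Pair → Set
Chain = AllPairs _≺_

chain-unique : ∀ {xs} → Chain xs → Unique xs
chain-unique = AllPairs.map proj₂

chain-related : ∀ {xs x y} → Chain xs → x ∈ xs → y ∈ xs → x ≡ y ⊎ x ≺ y ⊎ y ≺ x
chain-related (_  ∷ _)     (here refl) (here refl) = inj₁ refl
chain-related (x≺ ∷ _)     (here refl) (there y∈)  = inj₂ (inj₁ (All.lookup x≺ y∈))
chain-related (x≺ ∷ _)     (there x∈)  (here refl) = inj₂ (inj₂ (All.lookup x≺ x∈))
chain-related (_  ∷ chain) (there x∈)  (there y∈)  = chain-related chain x∈ y∈

chain-comparable : ∀ {xs x y} → Chain xs → x ∈ xs → y ∈ xs → x ≢ y → x ≼ y ⊎ y ≼ x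
chain-comparable chain x∈ y∈ x≢y with chain-related chain x∈ y∈
... | inj₁ x≡y        = ⊥-elim (x≢y x≡y)
... | inj₂ (inj₁ x≺y) = inj₁ (proj₁ x≺y)
... | inj₂ (inj₂ y≺x) = inj₂ (proj₁ y≺x)

chain-antichain : ∀ {C xs x y} → IsAntichain C → Chain xs → x ∈ xs → y ∈ xs → x ∈S C → y ∈S C → x ≡ y
chain-antichain {x = x} {y} anti chain x∈ y∈ x∈C y∈C with chain-related chain x∈ y∈
... | inj₁ x≡y             = x≡y
... | inj₂ (inj₁ (x≼y , _)) = anti x y x∈C y∈C x≼y
... | inj₂ (inj₂ (y≼x , _)) = sym (anti y x y∈C x∈C y≼x)

≼-head : ∀ {x xs y} → Chain (x ∷ xs) → y ∈ x ∷ xs → x ≼ y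
≼-head _          (here refl) = ≼-refl
≼-head (x≺ ∷ _) (there y∈)  = proj₁ (All.lookup x≺ y∈)

last-∷ : ∀ {A : Set} (x y : A) ys → last (x ∷ y ∷ ys) ≡ last (y ∷ ys)
last-∷ x y ys with initLast ys
... | []      = refl
... | _ ∷ʳ′ _ = refl

≼-last : ∀ {x xs y} → Linked _≼_ (x ∷ xs) → y ∈ x ∷ xs → y ≼ last (x ∷ xs)
≼-last {xs = []}    _          (here refl) = ≼-refl
≼-last {x} {z ∷ zs} (x≼z ∷ lk) (here refl) =
  subst (x ≼_) (sym (last-∷ x z zs)) (≼-trans x≼z (≼-last lk (here refl)))
≼-last {x} {z ∷ zs} (_ ∷ lk)   (there y∈)  = subst (_ ≼_) (sym (last-∷ x z zs)) (≼-last lk y∈)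

module _ {n d} (dyck : IsDyckPath n d) where

  private
    linked : Linked _≺_ (toList d)
    linked = Linked.map Step⇒≺ (proj₂ (proj₂ (proj₂ dyck)))

  dyck-valid : ∀ {y} → y ∈ toList d → ValidPair n y
  dyck-valid = All.lookup (proj₁ dyck)

  dyck-chain : Chain (toList d)
  dyck-chain = Linked⇒AllPairs ≺-trans linked

  dyck-bounds : ∀ {y} → y ∈ toList d → head⁺ d ≼ y × y ≼ last d
  dyck-bounds y∈ = ≼-head dyck-chain y∈ , ≼-last (Linked.map proj₁ linked) y∈

  start-bound : ∀ {y} → y ∈ toList d → proj₁ (head⁺ d) ≤ proj₁ y
  start-bound y∈ = proj₁ (proj₁ (dyck-bounds y∈))

  end-bound : ∀ {y} → y ∈ toList d → proj₂ y ≤ suc (proj₁ (last d))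
  end-bound y∈ =
    ℕP.≤-trans (proj₂ (proj₂ (dyck-bounds y∈))) (ℕP.≤-reflexive (proj₁ (proj₂ (proj₂ dyck))))

ind : Subset → Pair → ℕ
ind C (k , l) = if C k l then 1 else 0

hits : Subset → List Pair → ℕ
hits C = ℕΣ.sumBy (ind C)

ind-∈ : ∀ {C p} → p ∈S C → ind C p ≡ 1
ind-∈ p∈C rewrite p∈C = refl

ind-∉ : ∀ {C} p → ¬ p ∈S C → ind C p ≡ 0
ind-∉ {C} (k , l) p∉C with C k l
... | true  = ⊥-elim (p∉C refl)
... | false = refl

hits≥1 : ∀ {C xs x} → x ∈ xs → x ∈S C → 1 ≤ hits C xs
hits≥1 {C} {xs} x∈ x∈C = subst (_≤ hits C xs) (ind-∈ {C} x∈C) (sumBy-≥ (ind C) x∈)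

hits≤1 : ∀ {C xs} → IsAntichain C → Chain xs → hits C xs ≤ 1
hits≤1             _    []           = z≤n
hits≤1 {C} {x ∷ xs} anti (x≺ ∷ chain) with C (proj₁ x) (proj₂ x) in x∈C
... | true  = ℕP.≤-reflexive (cong suc (ℕΣ.sumBy-zero {f = ind C} {xs} λ {y} y∈ →
                let (x≼y , x≢y) = All.lookup x≺ y∈ in ind-∉ {C} y λ y∈C → x≢y (anti x y x∈C y∈C x≼y)))
... | false = hits≤1 anti chain

weighted-hits≤ : ∀ a {C xs} → IsAntichain C → Chain xs → a ℕ.* hits C xs ≤ a
weighted-hits≤ a anti chain =
  ℕP.≤-trans (ℕP.*-monoʳ-≤ a (hits≤1 anti chain)) (ℕP.≤-reflexive (ℕP.*-identityʳ a))

hits≡0⊎∈ : ∀ C xs → hits C xs ≡ 0 ⊎ ∃ λ x → x ∈ xs × x ∈S C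
hits≡0⊎∈ C []       = inj₁ refl
hits≡0⊎∈ C (x ∷ xs) with C (proj₁ x) (proj₂ x) in x∈C | hits≡0⊎∈ C xs
... | true  | _                   = inj₂ (x , here refl , x∈C)
... | false | inj₁ none           = inj₁ none
... | false | inj₂ (y , y∈ , y∈C) = inj₂ (y , there y∈ , y∈C)

ω : ℕ → ℕ → ℕ
ω j m = if does (m ℕ.≟ j) then 1 else 0

ω-self : ∀ j → ω j j ≡ 1
ω-self j rewrite dec-true (j ℕ.≟ j) refl = refl

ω-other : ∀ {j m} → m ≢ j → ω j m ≡ 0
ω-other {j} {m} m≢j rewrite dec-false (m ℕ.≟ j) m≢j = refl

twoWeight≡ω : ∀ i a a′ m → twoWeight i a a′ m ≡ a ℕ.* ω i m ℕ.+ a′ ℕ.* ω (suc i) m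
twoWeight≡ω i a a′ m with m ℕ.≟ i | m ℕ.≟ suc i
... | yes refl | yes m≡1+m = ⊥-elim (ℕP.1+n≢n (sym m≡1+m))
... | yes refl | no m≢1+m
  rewrite ω-self m | ω-other m≢1+m | ℕP.*-identityʳ a | ℕP.*-zeroʳ a′ = sym (ℕP.+-identityʳ a)
... | no m≢i   | yes refl
  rewrite ω-other m≢i | ω-self m | ℕP.*-identityʳ a′ | ℕP.*-zeroʳ a = refl
... | no m≢i   | no m≢1+i
  rewrite ω-other m≢i | ω-other m≢1+i | ℕP.*-zeroʳ a | ℕP.*-zeroʳ a′ = refl

M-twoWeight : ∀ i a a′ d → M (twoWeight i a a′) d ≡ a ℕ.* M (ω i) d ℕ.+ a′ ℕ.* M (ω (suc i)) d
M-twoWeight i a a′ d = begin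
  ℕΣ.sumBy (λ t → twoWeight i a a′ (s ℕ.+ t)) ts
    ≡⟨ ℕΣ.sumBy-cong {xs = ts} (λ {t} _ → twoWeight≡ω i a a′ (s ℕ.+ t)) ⟩
  ℕΣ.sumBy (λ t → a ℕ.* ω i (s ℕ.+ t) ℕ.+ a′ ℕ.* ω (suc i) (s ℕ.+ t)) ts
    ≡⟨ ℕΣ.sumBy-+ (λ t → a ℕ.* ω i (s ℕ.+ t)) (λ t → a′ ℕ.* ω (suc i) (s ℕ.+ t)) ts ⟩
  ℕΣ.sumBy (λ t → a ℕ.* ω i (s ℕ.+ t)) ts ℕ.+ ℕΣ.sumBy (λ t → a′ ℕ.* ω (suc i) (s ℕ.+ t)) ts
    ≡⟨ cong₂ ℕ._+_ (ℕΣ.sumBy-*ˡ a (ω i ∘ (s ℕ.+_)) ts) (ℕΣ.sumBy-*ˡ a′ (ω (suc i) ∘ (s ℕ.+_)) ts) ⟩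
  a ℕ.* M (ω i) d ℕ.+ a′ ℕ.* M (ω (suc i)) d ∎
  where
  open ≡-Reasoning
  s = proj₁ (head⁺ d)
  ts = upTo (suc (proj₁ (last d) ∸ s))

range : ℕ → ℕ → List ℕ
range s e = map (s ℕ.+_) (upTo (suc (e ∸ s)))

rangeSum≡sumBy : ∀ b s e → rangeSum b s e ≡ ℕΣ.sumBy b (range s e)
rangeSum≡sumBy b s e = cong (foldr ℕ._+_ 0) (map-∘ (upTo (suc (e ∸ s))))

range-unique : ∀ s e → Unique (range s e)
range-unique s e = Unique.map⁺ (ℕP.+-cancelˡ-≡ s _ _) (Unique.upTo⁺ (suc (e ∸ s)))

∈-range⁺ : ∀ {s e j} → s ≤ j → j ≤ e → j ∈ range s e
∈-range⁺ {s} {e} s≤j j≤e =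
  subst (_∈ range s e) (ℕP.m+[n∸m]≡n s≤j) (∈-map⁺ (s ℕ.+_) (∈-upTo⁺ (s≤s (ℕP.∸-monoˡ-≤ s j≤e))))

∈-range⁻ : ∀ {s e j} → s ≤ e → j ∈ range s e → s ≤ j × j ≤ e
∈-range⁻ {s} {e} s≤e j∈ with ∈-map⁻ (s ℕ.+_) j∈
... | t , t∈ , refl = ℕP.m≤m+n s t ,
  ℕP.≤-trans (ℕP.+-monoʳ-≤ s (ℕP.≤-pred (∈-upTo⁻ t∈))) (ℕP.≤-reflexive (ℕP.m+[n∸m]≡n s≤e))

rangeSum-ω-∈ : ∀ {s e j} → j ∈ range s e → rangeSum (ω j) s e ≡ 1
rangeSum-ω-∈ {s} {e} {j} j∈ = trans (rangeSum≡sumBy (ω j) s e)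
  (trans (ℕΣ.sumBy-single {f = ω j} {range s e} (range-unique s e) j∈ (λ {m} _ → ω-other {j} {m}))
         (ω-self j))

rangeSum-ω-∉ : ∀ {s e j} → j ∉ range s e → rangeSum (ω j) s e ≡ 0
rangeSum-ω-∉ {s} {e} {j} j∉ = trans (rangeSum≡sumBy (ω j) s e)
  (ℕΣ.sumBy-zero {f = ω j} {range s e} λ {m} m∈ → ω-other {j} {m} λ { refl → j∉ m∈ })

M-ω≤1 : ∀ j d → M (ω j) d ≤ 1
M-ω≤1 j d with j ∈ℕ? range (proj₁ (head⁺ d)) (proj₁ (last d))
... | yes j∈ = ℕP.≤-reflexive (rangeSum-ω-∈ j∈)
... | no  j∉ = m≡0⇒m≤n (rangeSum-ω-∉ j∉)

module _ {n d} (dyck : IsDyckPath n d) where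

  private
    s = proj₁ (head⁺ d)
    e = proj₁ (last d)

    s≤e : s ≤ e
    s≤e = proj₁ (proj₂ (dyck-bounds dyck (here refl)))

  M-ω-below : ∀ {j} → j < s → M (ω j) d ≡ 0
  M-ω-below j<s = rangeSum-ω-∉ λ j∈ → ℕP.<⇒≱ j<s (proj₁ (∈-range⁻ s≤e j∈))

  M-ω-above : ∀ {j} → e < j → M (ω j) d ≡ 0
  M-ω-above e<j = rangeSum-ω-∉ λ j∈ → ℕP.<⇒≱ e<j (proj₂ (∈-range⁻ s≤e j∈))

  M-ω-Q : ∀ {m y} → y ∈ toList d → InQ n m y → M (ω m) d ≡ 1
  M-ω-Q y∈ (_ , k≤m , m<l , _) = rangeSum-ω-∈ (∈-range⁺ (ℕP.≤-trans (start-bound dyck y∈) k≤m)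
    (ℕP.≤-pred (ℕP.<-≤-trans m<l (end-bound dyck y∈))))

  hits≤M-ω : ∀ {C m} → IsAntichain C → SubsetOfQ n m C → hits C (toList d) ≤ M (ω m) d
  hits≤M-ω {C} anti C⊆Q with hits≡0⊎∈ C (toList d)
  ... | inj₁ none           = m≡0⇒m≤n none
  ... | inj₂ (y , y∈ , y∈C) =
    ℕP.≤-trans (hits≤1 anti (dyck-chain dyck)) (ℕP.≤-reflexive (sym (M-ω-Q y∈ (C⊆Q y y∈C))))

-- Hook paths

bend : ℕ → ℕ → Pair → List Pair
bend (suc m) r       (k , l) = (k , suc l) ∷ bend m r (k , suc l)
bend zero    (suc r) (k , l) = (suc k , l) ∷ bend zero r (suc k , l)
bend zero    zero    _       = []

bend-linked : ∀ m r p → Linked Step (p ∷ bend m r p)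
bend-linked (suc m) r       (k , l) = inj₂ (refl , refl) ∷ bend-linked m r (k , suc l)
bend-linked zero    (suc r) (k , l) = inj₁ (refl , refl) ∷ bend-linked zero r (suc k , l)
bend-linked zero    zero    _       = [-]

bend-last : ∀ m r k l → last ((k , l) ∷ bend m r (k , l)) ≡ (k ℕ.+ r , l ℕ.+ m)
bend-last (suc m) r k l = begin
  last ((k , l) ∷ (k , suc l) ∷ bend m r (k , suc l)) ≡⟨ last-∷ (k , l) (k , suc l) (bend m r (k , suc l)) ⟩
  last ((k , suc l) ∷ bend m r (k , suc l))           ≡⟨ bend-last m r k (suc l) ⟩
  (k ℕ.+ r , suc l ℕ.+ m)                              ≡⟨ cong (k ℕ.+ r ,_) (ℕP.+-suc l m) ⟨
  (k ℕ.+ r , l ℕ.+ suc m)                              ∎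
  where open ≡-Reasoning
bend-last zero (suc r) k l = begin
  last ((k , l) ∷ (suc k , l) ∷ bend zero r (suc k , l)) ≡⟨ last-∷ (k , l) (suc k , l) (bend zero r (suc k , l)) ⟩
  last ((suc k , l) ∷ bend zero r (suc k , l))           ≡⟨ bend-last zero r (suc k) l ⟩
  (suc k ℕ.+ r , l ℕ.+ 0)                                 ≡⟨ cong (_, l ℕ.+ 0) (ℕP.+-suc k r) ⟨
  (k ℕ.+ suc r , l ℕ.+ 0)                                 ∎
  where open ≡-Reasoning
bend-last zero zero k l = cong₂ _,_ (sym (ℕP.+-identityʳ k)) (sym (ℕP.+-identityʳ l))

bend-valid : ∀ {n} m r k l → 1 ≤ k → k < l → k ℕ.+ r < l ℕ.+ m → l ℕ.+ m ≤ n →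
             All (ValidPair n) ((k , l) ∷ bend m r (k , l))
bend-valid {n} (suc m) r k l 1≤k k<l k+r<l+m l+m≤n =
  (1≤k , k<l , ℕP.≤-trans (ℕP.m≤m+n l (suc m)) l+m≤n) ∷
  bend-valid m r k (suc l) 1≤k (ℕP.m<n⇒m<1+n k<l)
    (subst (k ℕ.+ r <_) (ℕP.+-suc l m) k+r<l+m) (subst (_≤ n) (ℕP.+-suc l m) l+m≤n)
bend-valid zero (suc r) k l 1≤k k<l k+r<l l≤n =
  (1≤k , k<l , ℕP.≤-trans (ℕP.m≤m+n l 0) l≤n) ∷
  bend-valid zero r (suc k) l (s≤s z≤n)
    (subst (suc k <_) (ℕP.+-identityʳ l) (ℕP.≤-<-trans (s≤s (ℕP.m≤m+n k r)) k+1+r<l)) k+1+r<l l≤n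
  where
  k+1+r<l : suc k ℕ.+ r < l ℕ.+ 0
  k+1+r<l = subst (_< l ℕ.+ 0) (ℕP.+-suc k r) k+r<l
bend-valid zero zero k l 1≤k k<l _ l≤n = (1≤k , k<l , ℕP.≤-trans (ℕP.m≤m+n l 0) l≤n) ∷ []

∈-bend-column : ∀ m r k l {b} → l ≤ b → b ≤ l ℕ.+ m → (k , b) ∈ (k , l) ∷ bend m r (k , l)
∈-bend-column zero    r k l {b} l≤b b≤l =
  here (cong (k ,_) (ℕP.≤-antisym (subst (b ≤_) (ℕP.+-identityʳ l) b≤l) l≤b))
∈-bend-column (suc m) r k l {b} l≤b b≤l+m with ℕP.m≤n⇒m<n∨m≡n l≤b
... | inj₁ l<b  = there (∈-bend-column m r k (suc l) l<b (subst (b ≤_) (ℕP.+-suc l m) b≤l+m))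
... | inj₂ refl = here refl

∈-bend-row : ∀ m r k l {a} → k ≤ a → a ≤ k ℕ.+ r → (a , l ℕ.+ m) ∈ (k , l) ∷ bend m r (k , l)
∈-bend-row (suc m) r k l {a} k≤a a≤k+r =
  there (subst (λ z → (a , z) ∈ bend (suc m) r (k , l)) (sym (ℕP.+-suc l m))
               (∈-bend-row m r k (suc l) k≤a a≤k+r))
∈-bend-row zero zero k l {a} k≤a a≤k =
  here (cong₂ _,_ (ℕP.≤-antisym (subst (a ≤_) (ℕP.+-identityʳ k) a≤k) k≤a) (ℕP.+-identityʳ l))
∈-bend-row zero (suc r) k l {a} k≤a a≤k+r with ℕP.m≤n⇒m<n∨m≡n k≤a
... | inj₁ k<a  = there (∈-bend-row zero r (suc k) l k<a (subst (a ≤_) (ℕP.+-suc k r) a≤k+r))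
... | inj₂ refl = here (cong (k ,_) (ℕP.+-identityʳ l))

record DyckThrough (n : ℕ) (p q : Pair) : Set where
  field
    path  : List⁺ Pair
    dyck  : IsDyckPath n path
    ∋p    : p ∈ toList path
    ∋q    : q ∈ toList path
    start : proj₁ (head⁺ path) ≡ proj₁ p
    end   : suc (proj₁ (last path)) ≡ proj₂ q

-- The hook from (k , k+1) up to the corner (k , L) and across to (L-1 , L).
dyckThrough : ∀ {n p q} → ValidPair n p → ValidPair n q → p ≼ q → DyckThrough n p q
dyckThrough {n} {k , l} {a , L} (1≤k , k<l , _) (_ , a<L , L≤n) (k≤a , l≤L) = record
  { path  = hook
  ; dyck  = bend-valid u u k (suc k) 1≤k ℕP.≤-refl ℕP.≤-refl (subst (_≤ n) (sym k+1+u≡L) L≤n)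
          , refl
          , subst (λ z → proj₂ z ≡ suc (proj₁ z)) (sym last≡) refl
          , bend-linked u u (k , suc k)
  ; ∋p    = ∈-bend-column u u k (suc k) k<l (subst (l ≤_) (sym k+1+u≡L) l≤L)
  ; ∋q    = subst (λ z → (a , z) ∈ toList hook) k+1+u≡L
              (∈-bend-row u u k (suc k) k≤a (ℕP.≤-pred (subst (a <_) (sym k+1+u≡L) a<L)))
  ; start = refl
  ; end   = trans (cong (suc ∘ proj₁) last≡) k+1+u≡L
  }
  where
  u = L ∸ suc k
  k+1+u≡L : suc k ℕ.+ u ≡ L
  k+1+u≡L = ℕP.m+[n∸m]≡n (ℕP.<-≤-trans k<l l≤L)
  hook : List⁺ Pair
  hook = (k , suc k) ∷ bend u u (k , suc k)
  last≡ : last hook ≡ (k ℕ.+ u , suc k ℕ.+ u)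
  last≡ = bend-last u u k (suc k)

dyckThrough-comparable : ∀ {n p q} → ValidPair n p → ValidPair n q → p ≼ q ⊎ q ≼ p →
                         ∃ λ d → IsDyckPath n d × p ∈ toList d × q ∈ toList d
dyckThrough-comparable valid-p valid-q (inj₁ p≼q) = path , dyck , ∋p , ∋q
  where open DyckThrough (dyckThrough valid-p valid-q p≼q)
dyckThrough-comparable valid-p valid-q (inj₂ q≼p) = path , dyck , ∋q , ∋p
  where open DyckThrough (dyckThrough valid-q valid-p q≼p)

Q⇒valid : ∀ {n m p} → InQ n m p → ValidPair n p
Q⇒valid (1≤k , k≤m , m<l , l≤n) = 1≤k , ℕP.≤-<-trans k≤m m<l , l≤n

outside-Qi+1 : ∀ {n i q} → InQ n i q → ¬ (InQ n i q × InQ n (suc i) q) → proj₂ q ≡ suc i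
outside-Qi+1 {i = i} {k , l} q∈Qi@(1≤k , k≤i , i<l , l≤n) outer with suc (suc i) ℕ.≤? l
... | yes i+1<l = ⊥-elim (outer (q∈Qi , 1≤k , ℕP.m≤n⇒m≤1+n k≤i , i+1<l , l≤n))
... | no  i+1≮l = ℕP.≤-antisym (ℕP.≤-pred (ℕP.≰⇒> i+1≮l)) i<l

outside-Qi : ∀ {n i q} → InQ n (suc i) q → ¬ (InQ n i q × InQ n (suc i) q) → proj₁ q ≡ suc i
outside-Qi {i = i} {k , l} q∈Qi+1@(1≤k , k≤i+1 , i+1<l , l≤n) outer with k ℕ.≤? i
... | yes k≤i = ⊥-elim (outer ((1≤k , k≤i , ℕP.<⇒≤ i+1<l , l≤n) , q∈Qi+1))
... | no  k≰i = ℕP.≤-antisym k≤i+1 (ℕP.≰⇒> k≰i)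

InQ? : ∀ n m p → Dec (InQ n m p)
InQ? n m (k , l) = (1 ℕ.≤? k) ×-dec (k ℕ.≤? m) ×-dec (suc m ℕ.≤? l) ×-dec (l ℕ.≤? n)

pairsUpTo : ℕ → List Pair
pairsUpTo n = cartesianProduct (upTo (suc n)) (upTo (suc n))

valid∈pairsUpTo : ∀ {n p} → ValidPair n p → p ∈ pairsUpTo n
valid∈pairsUpTo (_ , k<l , l≤n) =
  ∈-cartesianProduct⁺ (∈-upTo⁺ (s≤s (ℕP.≤-trans (ℕP.<⇒≤ k<l) l≤n))) (∈-upTo⁺ (s≤s l≤n))

_∖_ : Subset → Subset → Subset
(X ∖ Y) k l = X k l ∧ not (Y k l)

∈-∖⁺ : ∀ {X Y} p → p ∈S X → ¬ p ∈S Y → p ∈S (X ∖ Y)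
∈-∖⁺ {X} {Y} (k , l) p∈X p∉Y with Y k l
... | true  = ⊥-elim (p∉Y refl)
... | false rewrite p∈X = refl

∈-∖⁻ : ∀ {X Y} p → p ∈S (X ∖ Y) → p ∈S X × ¬ p ∈S Y
∈-∖⁻ {X} {Y} (k , l) p∈X∖Y with X k l | Y k l
∈-∖⁻ (k , l) _  | true  | false = refl , λ ()
∈-∖⁻ (k , l) () | true  | true
∈-∖⁻ (k , l) () | false | _

ind-∖≤ : ∀ {X Y} p → ind (X ∖ Y) p ≤ ind X p
ind-∖≤ {X} {Y} (k , l) with X k l | Y k l
... | true  | true  = z≤n
... | true  | false = ℕP.≤-refl
... | false | _     = z≤n

∖-antichain : ∀ {X Y} → IsAntichain X → IsAntichain (X ∖ Y)
∖-antichain {X} {Y} anti p q p∈ q∈ =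
  anti p q (proj₁ (∈-∖⁻ {X} {Y} p p∈)) (proj₁ (∈-∖⁻ {X} {Y} q q∈))

_∈S?_ : ∀ p C → Dec (p ∈S C)
(k , l) ∈S? C = C k l Bool.≟ true

node? : ∀ A B p → Dec (Node A B p)
node? A B p = (p ∈S? A) ⊎-dec (p ∈S? B)

_≟ₚ_ : DecidableEquality Pair
_≟ₚ_ = ≡-dec ℕ._≟_ ℕ._≟_

open import Data.List.Membership.DecPropositional _≟ₚ_ using () renaming (_∈?_ to _∈ₚ?_)

adj? : ∀ A B p q → Dec (Adj A B p q)
adj? A B p q = node? A B p ×-dec node? A B q ×-dec ¬? (p ≟ₚ q) ×-dec (≼? p q ⊎-dec ≼? q p)
  where
  ≼? : ∀ p q → Dec (p ≼ q)
  ≼? (k , l) (k′ , l′) = (k ℕ.≤? k′) ×-dec (l ℕ.≤? l′)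

χ≡ind : ∀ C k l → χ C k l ≡ ℕ→ℚ (ind C (k , l))
χ≡ind C k l with C k l
... | true  = refl
... | false = refl

pathSum-ℕ : ∀ (x : Point) (f : Pair → ℕ) → (∀ k l → x k l ≡ ℕ→ℚ (f (k , l))) →
            ∀ d → pathSum x d ≡ ℕ→ℚ (ℕΣ.sumBy f (toList d))
pathSum-ℕ x f x≡f d =
  trans (ℚΣ.sumBy-cong {xs = toList d} λ {p} _ → x≡f (proj₁ p) (proj₂ p)) (sym (ℕ→ℚ-sumBy f (toList d)))

ℕ-point-InP : ∀ {n b} (x : Point) (f : Pair → ℕ) → (∀ k l → x k l ≡ ℕ→ℚ (f (k , l))) →
              (∀ d → IsDyckPath n d → ℕΣ.sumBy f (toList d) ≤ M b d) → InP n b x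
ℕ-point-InP {b = b} x f x≡f bound =
  (λ k l _ → subst (0ℚ ℚ.≤_) (sym (x≡f k l)) (ℕ→ℚ-mono-≤ {0} {f (k , l)} z≤n)) ,
  (λ d dyck → subst (ℚ._≤ ℕ→ℚ (M b d)) (sym (pathSum-ℕ x f x≡f d)) (ℕ→ℚ-mono-≤ (bound d dyck)))

at : Point → Pair → ℚ
at x (k , l) = x k l

-- The vertex criterion

module Vertex (n i ai ai1 : ℕ) (A B : Subset)
              (A⊆Qi : SubsetOfQ n i A) (antiA : IsAntichain A)
              (B⊆Qi+1 : SubsetOfQ n (suc i) B) (antiB : IsAntichain B) where

  μ : ℕ → ℕ
  μ = twoWeight i ai ai1

  v : Point
  v k l = ℕ→ℚ ai ℚ.* χ A k l ℚ.+ ℕ→ℚ ai1 ℚ.* χ B k l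

  vℕ : Pair → ℕ
  vℕ p = ai ℕ.* ind A p ℕ.+ ai1 ℕ.* ind B p

  Condition : Set
  Condition = ∀ p → Node A B p → ((p ∈S A) × (p ∈S B)) ⊎ InΔ n i A B p

  v≡vℕ : ∀ k l → v k l ≡ ℕ→ℚ (vℕ (k , l))
  v≡vℕ k l = sym (trans (ℕ→ℚ-+ (ai ℕ.* ind A (k , l)) _) (cong₂ ℚ._+_
    (trans (ℕ→ℚ-* ai _) (cong (ℕ→ℚ ai ℚ.*_) (sym (χ≡ind A k l))))
    (trans (ℕ→ℚ-* ai1 _) (cong (ℕ→ℚ ai1 ℚ.*_) (sym (χ≡ind B k l))))))

  v-off : ∀ p → ¬ Node A B p → at v p ≡ 0ℚ
  v-off p ¬node rewrite v≡vℕ (proj₁ p) (proj₂ p)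
                      | ind-∉ {A} p (¬node ∘ inj₁) | ind-∉ {B} p (¬node ∘ inj₂)
                      | ℕP.*-zeroʳ ai | ℕP.*-zeroʳ ai1 = refl

  sumBy-vℕ : ∀ xs → ℕΣ.sumBy vℕ xs ≡ ai ℕ.* hits A xs ℕ.+ ai1 ℕ.* hits B xs
  sumBy-vℕ xs = trans (ℕΣ.sumBy-+ (λ p → ai ℕ.* ind A p) (λ p → ai1 ℕ.* ind B p) xs)
                      (cong₂ ℕ._+_ (ℕΣ.sumBy-*ˡ ai (ind A) xs) (ℕΣ.sumBy-*ˡ ai1 (ind B) xs))

  v-bound : ∀ d → IsDyckPath n d → ℕΣ.sumBy vℕ (toList d) ≤ M μ d
  v-bound d dyck = begin
    ℕΣ.sumBy vℕ (toList d)                                ≡⟨ sumBy-vℕ (toList d) ⟩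
    ai ℕ.* hits A (toList d) ℕ.+ ai1 ℕ.* hits B (toList d)
      ≤⟨ ℕP.+-mono-≤ (ℕP.*-monoʳ-≤ ai (hits≤M-ω dyck antiA A⊆Qi))
                     (ℕP.*-monoʳ-≤ ai1 (hits≤M-ω dyck antiB B⊆Qi+1)) ⟩
    ai ℕ.* M (ω i) d ℕ.+ ai1 ℕ.* M (ω (suc i)) d          ≡⟨ M-twoWeight i ai ai1 d ⟨
    M μ d                                                  ∎
    where open ℕP.≤-Reasoning

  v∈P : InP n μ v
  v∈P = ℕ-point-InP {b = μ} v vℕ v≡vℕ v-bound

  Tight : List⁺ Pair → Set
  Tight d = ℕΣ.sumBy vℕ (toList d) ≡ M μ d

  tight : ∀ {d} → IsDyckPath n d →
          M (ω i) d ≤ hits A (toList d) → M (ω (suc i)) d ≤ hits B (toList d) → Tight d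
  tight {d} dyck ωi≤A ωi+1≤B = ℕP.≤-antisym (v-bound d dyck) (begin
    M μ d                                                    ≡⟨ M-twoWeight i ai ai1 d ⟩
    ai ℕ.* M (ω i) d ℕ.+ ai1 ℕ.* M (ω (suc i)) d
      ≤⟨ ℕP.+-mono-≤ (ℕP.*-monoʳ-≤ ai ωi≤A) (ℕP.*-monoʳ-≤ ai1 ωi+1≤B) ⟩
    ai ℕ.* hits A (toList d) ℕ.+ ai1 ℕ.* hits B (toList d)  ≡⟨ sumBy-vℕ (toList d) ⟨
    ℕΣ.sumBy vℕ (toList d)                                  ∎)
    where open ℕP.≤-Reasoning

  M-ω≤hits : ∀ {d x C} j → x ∈ toList d → x ∈S C → M (ω j) d ≤ hits C (toList d)
  M-ω≤hits {d} j x∈ x∈C = ℕP.≤-trans (M-ω≤1 j d) (hits≥1 x∈ x∈C)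

  nodes-on-chain : ∀ {xs a b x} → Chain xs → a ∈ xs → a ∈S A → b ∈ xs → b ∈S B →
                   x ∈ xs → Node A B x → x ≡ a ⊎ x ≡ b
  nodes-on-chain chain a∈ a∈A _  _   x∈ (inj₁ x∈A) = inj₁ (chain-antichain antiA chain x∈ a∈ x∈A a∈A)
  nodes-on-chain chain _  _   b∈ b∈B x∈ (inj₂ x∈B) = inj₂ (chain-antichain antiB chain x∈ b∈ x∈B b∈B)

  -- Case splits whose goal mentions v go through helper functions rather than `with`:
  -- with-abstraction normalises the goal, and normalising v's rational arithmetic explodes.
  module Agreement (w : Point)
    (w-off : ∀ {p} → ValidPair n p → ¬ Node A B p → at w p ≡ 0ℚ)
    (w-tight : ∀ d → IsDyckPath n d → pathSum v d ≡ ℕ→ℚ (M μ d) → pathSum w d ≡ ℕ→ℚ (M μ d)) where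

    Agree : Pair → Set
    Agree p = at w p ≡ at v p

    agree-off : ∀ {p} → ValidPair n p → ¬ Node A B p → Agree p
    agree-off {p} valid ¬node = trans (w-off valid ¬node) (sym (v-off p ¬node))

    agree-along : ∀ {d p} → IsDyckPath n d → Tight d → p ∈ toList d →
                  (∀ {x} → x ∈ toList d → Node A B x → x ≢ p → Agree x) → Agree p
    agree-along {d} {p} dyck tight-d p∈ agree-nodes =
      sumBy-cancel {f = at w} {at v} {toList d} (chain-unique (dyck-chain dyck)) p∈
        (λ x∈ x≢p → agree-at x∈ x≢p (node? A B _)) (trans (w-tight d dyck v-tight) (sym v-tight))
      where
      v-tight : pathSum v d ≡ ℕ→ℚ (M μ d)
      v-tight = trans (pathSum-ℕ v vℕ v≡vℕ d) (cong ℕ→ℚ tight-d)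
      agree-at : ∀ {x} → x ∈ toList d → x ≢ p → Dec (Node A B x) → Agree x
      agree-at x∈ x≢p (yes node) = agree-nodes x∈ node x≢p
      agree-at x∈ x≢p (no ¬node) = agree-off (dyck-valid dyck x∈) ¬node

    agree-via : ∀ {d p q} → IsDyckPath n d → Tight d → p ∈ toList d →
                (∀ {x} → x ∈ toList d → Node A B x → x ≡ p ⊎ x ≡ q) → Agree q → Agree p
    agree-via dyck tight-d p∈ nodes agree-q = agree-along dyck tight-d p∈ λ x∈ node x≢p →
      [ ⊥-elim ∘ x≢p , (λ { refl → agree-q }) ]′ (nodes x∈ node)

    agree-AB : ∀ {p} → p ∈S A → p ∈S B → Agree p
    agree-AB {p} p∈A p∈B =
      agree-along dyck (tight dyck (M-ω≤hits i ∋p p∈A) (M-ω≤hits (suc i) ∋p p∈B)) ∋p λ x∈ node x≢p →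
        ⊥-elim (x≢p ([ id , id ]′ (nodes-on-chain (dyck-chain dyck) ∋p p∈A ∋p p∈B x∈ node)))
      where
      valid = Q⇒valid (A⊆Qi p p∈A)
      open DyckThrough (dyckThrough valid valid ≼-refl)

    agree-out : ∀ {q} → Node A B q → ¬ (InQ n i q × InQ n (suc i) q) → Agree q
    agree-out {q} (inj₁ q∈A) out =
      agree-along dyck (tight dyck (M-ω≤hits i ∋p q∈A) (m≡0⇒m≤n (M-ω-above dyck e<i+1))) ∋p only-q
      where
      q∈Qi = A⊆Qi q q∈A
      valid = Q⇒valid q∈Qi
      open DyckThrough (dyckThrough valid valid ≼-refl)
      e+1≡i+1 : suc (proj₁ (last path)) ≡ suc i
      e+1≡i+1 = trans end (outside-Qi+1 q∈Qi out)
      e<i+1 : proj₁ (last path) < suc i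
      e<i+1 = ℕP.≤-reflexive e+1≡i+1
      only-q : ∀ {x} → x ∈ toList path → Node A B x → x ≢ q → Agree x
      only-q x∈ (inj₁ x∈A) x≢q = ⊥-elim (x≢q (chain-antichain antiA (dyck-chain dyck) x∈ ∋p x∈A q∈A))
      only-q x∈ (inj₂ x∈B) x≢q = ⊥-elim (ℕP.<⇒≱ (proj₁ (proj₂ (proj₂ (B⊆Qi+1 _ x∈B))))
        (ℕP.≤-trans (end-bound dyck x∈) (ℕP.≤-reflexive e+1≡i+1)))
    agree-out {q} (inj₂ q∈B) out =
      agree-along dyck (tight dyck (m≡0⇒m≤n (M-ω-below dyck i<s)) (M-ω≤hits (suc i) ∋p q∈B)) ∋p only-q
      where
      q∈Qi+1 = B⊆Qi+1 q q∈B
      valid = Q⇒valid q∈Qi+1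
      open DyckThrough (dyckThrough valid valid ≼-refl)
      s≡i+1 : proj₁ (head⁺ path) ≡ suc i
      s≡i+1 = trans start (outside-Qi q∈Qi+1 out)
      i<s : i < proj₁ (head⁺ path)
      i<s = ℕP.≤-reflexive (sym s≡i+1)
      only-q : ∀ {x} → x ∈ toList path → Node A B x → x ≢ q → Agree x
      only-q x∈ (inj₁ x∈A) x≢q = ⊥-elim (ℕP.<⇒≱ i<s
        (ℕP.≤-trans (start-bound dyck x∈) (proj₁ (proj₂ (A⊆Qi _ x∈A)))))
      only-q x∈ (inj₂ x∈B) x≢q = ⊥-elim (x≢q (chain-antichain antiB (dyck-chain dyck) x∈ ∋p x∈B q∈B))

    agree-mixed : ∀ {a b} → a ∈S A → b ∈S B → a ≼ b ⊎ b ≼ a →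
                  (Agree a → Agree b) × (Agree b → Agree a)
    agree-mixed {a} {b} a∈A b∈B a~b =
      along (dyckThrough-comparable (Q⇒valid (A⊆Qi a a∈A)) (Q⇒valid (B⊆Qi+1 b b∈B)) a~b)
      where
      along : (∃ λ d → IsDyckPath n d × a ∈ toList d × b ∈ toList d) →
              (Agree a → Agree b) × (Agree b → Agree a)
      along (d , dyck , a∈ , b∈) =
        agree-via dyck tight-d b∈ (swap ∘₂ nodes) , agree-via dyck tight-d a∈ nodes
        where
        tight-d = tight dyck (M-ω≤hits i a∈ a∈A) (M-ω≤hits (suc i) b∈ b∈B)
        nodes : ∀ {x} → x ∈ toList d → Node A B x → x ≡ a ⊎ x ≡ b
        nodes = nodes-on-chain (dyck-chain dyck) a∈ a∈A b∈ b∈B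

    agree-adj : ∀ {p q} → Adj A B p q → Agree q → Agree p
    agree-adj (inj₁ p∈A , inj₁ q∈A , p≢q , p~q) = ⊥-elim (p≢q (comparable-antichain antiA p∈A q∈A p~q))
    agree-adj (inj₂ p∈B , inj₂ q∈B , p≢q , p~q) = ⊥-elim (p≢q (comparable-antichain antiB p∈B q∈B p~q))
    agree-adj (inj₁ p∈A , inj₂ q∈B , _ , p~q)   = proj₂ (agree-mixed p∈A q∈B p~q)
    agree-adj (inj₂ p∈B , inj₁ q∈A , _ , p~q)   = proj₁ (agree-mixed q∈A p∈B (swap p~q))

    agree-Δ : ∀ {p} → InΔ n i A B p → Agree p
    agree-Δ (q , node , out , ε)          = agree-out node out
    agree-Δ (q , node , out , adj ◅ path) = agree-adj adj (agree-Δ (q , node , out , path))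

    agree : Condition → ∀ k l → ValidPair n (k , l) → w k l ≡ v k l
    agree cond k l valid = agree-at (node? A B (k , l))
      where
      agree-at : Dec (Node A B (k , l)) → Agree (k , l)
      agree-at (no ¬node) = agree-off valid ¬node
      agree-at (yes node) = [ uncurry agree-AB , agree-Δ ]′ (cond (k , l) node)

  module Summand (s t : ℚ) (s>0 : ℚ.Positive s) (t>0 : ℚ.Positive t) (s+t≡1 : s ℚ.+ t ≡ 1ℚ)
              {x x′ : Point} (x∈P : InP n μ x) (x′∈P : InP n μ x′)
              (v≡ : (v ≈U (λ k l → s ℚ.* x k l ℚ.+ t ℚ.* x′ k l)) n) where

    off : ∀ {p} → ValidPair n p → ¬ Node A B p → at x p ≡ 0ℚ
    off {k , l} valid ¬node =
      mean≡lower⇒≡ {s} {t} s>0 t>0 s+t≡1 (proj₁ x∈P k l valid) (proj₁ x′∈P k l valid)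
        (trans (sym (v≡ k l valid)) (v-off (k , l) ¬node))

    pathSum-mean : ∀ {d} → IsDyckPath n d → pathSum v d ≡ s ℚ.* pathSum x d ℚ.+ t ℚ.* pathSum x′ d
    pathSum-mean {d} dyck = begin
      pathSum v d
        ≡⟨ ℚΣ.sumBy-cong {xs = toList d} (λ {p} p∈ → v≡ (proj₁ p) (proj₂ p) (dyck-valid dyck p∈)) ⟩
      ℚΣ.sumBy (λ p → s ℚ.* at x p ℚ.+ t ℚ.* at x′ p) (toList d)
        ≡⟨ ℚΣ.sumBy-+ (λ p → s ℚ.* at x p) (λ p → t ℚ.* at x′ p) (toList d) ⟩
      ℚΣ.sumBy (λ p → s ℚ.* at x p) (toList d) ℚ.+ ℚΣ.sumBy (λ p → t ℚ.* at x′ p) (toList d)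
        ≡⟨ cong₂ ℚ._+_ (ℚΣ.sumBy-*ˡ s (at x) (toList d)) (ℚΣ.sumBy-*ˡ t (at x′) (toList d)) ⟩
      s ℚ.* pathSum x d ℚ.+ t ℚ.* pathSum x′ d ∎
      where open ≡-Reasoning

    tight-x : ∀ d → IsDyckPath n d → pathSum v d ≡ ℕ→ℚ (M μ d) → pathSum x d ≡ ℕ→ℚ (M μ d)
    tight-x d dyck v-tight =
      mean≡upper⇒≡ {s} {t} s>0 t>0 s+t≡1 (proj₂ x∈P d dyck) (proj₂ x′∈P d dyck)
        (trans (sym (pathSum-mean dyck)) v-tight)

    open Agreement x off tight-x public using (agree)

  vertex⇐ : Condition → IsVertex n μ v
  vertex⇐ cond = v∈P , λ y z t y∈P z∈P 0<t t<1 v≡ k l valid →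
    trans (Summand.agree t (1ℚ ℚ.- t) (ℚ.positive 0<t) (1-p-positive t<1) (p+[1-p]≡1 t)
                         y∈P z∈P v≡ cond k l valid)
          (sym (Summand.agree (1ℚ ℚ.- t) t (1-p-positive t<1) (ℚ.positive 0<t)
                              (trans (ℚP.+-comm (1ℚ ℚ.- t) t) (p+[1-p]≡1 t))
                              z∈P y∈P (≈U-mean-comm {n} {v} {t} {1ℚ ℚ.- t} {y} {z} v≡) cond k l valid))

  node-valid : ∀ {p} → Node A B p → ValidPair n p
  node-valid (inj₁ p∈A) = Q⇒valid (A⊆Qi _ p∈A)
  node-valid (inj₂ p∈B) = Q⇒valid (B⊆Qi+1 _ p∈B)

  module Forward (1≤ai : 1 ≤ ai) (1≤ai1 : 1 ≤ ai1) where

    Out : Pair → Set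
    Out p = Node A B p × ¬ (InQ n i p × InQ n (suc i) p)

    out? : ∀ p → Dec (Out p)
    out? p = node? A B p ×-dec ¬? (InQ? n i p ×-dec InQ? n (suc i) p)

    Δ-back : ∀ {p q} → Adj A B p q → InΔ n i A B q → InΔ n i A B p
    Δ-back adj (r , node , out , path) = r , node , out , adj ◅ path

    open Saturation _≟ₚ_ (adj? A B) (InΔ n i A B) Δ-back (pairsUpTo n)

    seeds-in-Δ : ∀ {p} → p ∈ filter out? (pairsUpTo n) → InΔ n i A B p
    seeds-in-Δ {p} p∈ = let (node , outer) = proj₂ (∈-filter⁻ out? p∈) in p , node , outer , ε

    module Perturbation (saturated : Saturated (filter out? (pairsUpTo n))) where

      open Saturated saturated

      Reached : Subset
      Reached k l = does ((k , l) ∈ₚ? members)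

      reached⇒∈ : ∀ {p} → p ∈S Reached → p ∈ members
      reached⇒∈ {k , l} _ with (k , l) ∈ₚ? members
      ... | yes p∈ = p∈

      ∈⇒reached : ∀ {p} → p ∈ members → p ∈S Reached
      ∈⇒reached {p} p∈ = dec-true (p ∈ₚ? members) p∈

      unreached-inner : ∀ {p} → Node A B p → ¬ p ∈S Reached → InQ n i p × InQ n (suc i) p
      unreached-inner {p} node unreached with InQ? n i p ×-dec InQ? n (suc i) p
      ... | yes inner = inner
      ... | no  outer =
        ⊥-elim (unreached (∈⇒reached (seeded (∈-filter⁺ out? (valid∈pairsUpTo (node-valid node)) (node , outer)))))

      unreached-closed : ∀ {p q} → Adj A B p q → ¬ p ∈S Reached → ¬ q ∈S Reached
      unreached-closed adj p-unreached q-reached =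
        p-unreached (∈⇒reached (closed (valid∈pairsUpTo (node-valid (proj₁ adj))) adj (reached⇒∈ q-reached)))

      sole : Subset → Subset → Subset
      sole X Y = (X ∖ Y) ∖ Reached

      sole⁻ : ∀ {X Y p} → p ∈S sole X Y → p ∈S X × ¬ p ∈S Y × ¬ p ∈S Reached
      sole⁻ {X} {Y} {p} p∈ = let (p∈X∖Y , unreached) = ∈-∖⁻ {X ∖ Y} {Reached} p p∈
                                 (p∈X , p∉Y) = ∈-∖⁻ {X} {Y} p p∈X∖Y
                             in p∈X , p∉Y , unreached

      sole⁺ : ∀ {X Y p} → p ∈S X → ¬ p ∈S Y → ¬ p ∈S Reached → p ∈S sole X Y
      sole⁺ {X} {Y} {p} p∈X p∉Y unreached = ∈-∖⁺ {X ∖ Y} {Reached} p (∈-∖⁺ {X} {Y} p p∈X p∉Y) unreached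

      sole-antichain : ∀ {X Y} → IsAntichain X → IsAntichain (sole X Y)
      sole-antichain {X} {Y} anti = ∖-antichain {X ∖ Y} {Reached} (∖-antichain {X} {Y} anti)

      -- An unreached node of X ∖ Y on a chain is adjacent to every Y-node of the chain, so
      -- those are unreached too and lie in Y ∖ X.
      sole-partner : ∀ {X Y xs a} → IsAntichain X →
                    (∀ {p q} → p ∈S X → q ∈S Y → p ≢ q → p ≼ q ⊎ q ≼ p → Adj A B p q) →
                    Chain xs → a ∈ xs → a ∈S sole X Y → 1 ≤ hits (sole Y X) xs ⊎ hits Y xs ≡ 0
      sole-partner {X} {Y} {xs} {a} antiX adj chain a∈ a∈sole with hits≡0⊎∈ Y xs
      ... | inj₁ none = inj₂ none
      ... | inj₂ (b , b∈ , b∈Y) = inj₁ (hits≥1 b∈ (sole⁺ {Y} {X} b∈Y b∉X b-unreached))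
        where
        a∈X = proj₁ (sole⁻ {X} {Y} a∈sole)
        a≢b : a ≢ b
        a≢b refl = proj₁ (proj₂ (sole⁻ {X} {Y} a∈sole)) b∈Y
        b∉X : ¬ b ∈S X
        b∉X b∈X = a≢b (chain-antichain antiX chain a∈ b∈ a∈X b∈X)
        b-unreached : ¬ b ∈S Reached
        b-unreached = unreached-closed (adj a∈X b∈Y a≢b (chain-comparable chain a∈ b∈ a≢b))
                        (proj₂ (proj₂ (sole⁻ {X} {Y} a∈sole)))

      M-unreached : ∀ {d a} → IsDyckPath n d → a ∈ toList d → Node A B a → ¬ a ∈S Reached →
                    M μ d ≡ ai ℕ.+ ai1
      M-unreached {d} dyck a∈ node unreached
        rewrite M-twoWeight i ai ai1 d
              | M-ω-Q dyck a∈ (proj₁ (unreached-inner node unreached))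
              | M-ω-Q dyck a∈ (proj₂ (unreached-inner node unreached))
              = cong₂ ℕ._+_ (ℕP.*-identityʳ ai) (ℕP.*-identityʳ ai1)

      vℕ<M : ∀ {d a} → IsDyckPath n d → a ∈ toList d → Node A B a → ¬ a ∈S Reached →
             hits A (toList d) ≡ 0 ⊎ hits B (toList d) ≡ 0 → ℕΣ.sumBy vℕ (toList d) < M μ d
      vℕ<M {d} dyck a∈ node unreached none
        rewrite sumBy-vℕ (toList d) | M-unreached dyck a∈ node unreached with none
      ... | inj₁ noA rewrite noA | ℕP.*-zeroʳ ai =
        ℕP.≤-<-trans (weighted-hits≤ ai1 antiB (dyck-chain dyck)) (ℕP.m<n+m ai1 1≤ai)
      ... | inj₂ noB rewrite noB | ℕP.*-zeroʳ ai1 | ℕP.+-identityʳ (ai ℕ.* hits A (toList d)) =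
        ℕP.≤-<-trans (weighted-hits≤ ai antiA (dyck-chain dyck)) (ℕP.m<m+n ai 1≤ai1)

      sole-slack : ∀ {X Y d} → IsAntichain X →
               (∀ {p q} → p ∈S X → q ∈S Y → p ≢ q → p ≼ q ⊎ q ≼ p → Adj A B p q) →
               (∀ {p} → p ∈S X → Node A B p) → (∀ {xs} → hits Y xs ≡ 0 → hits A xs ≡ 0 ⊎ hits B xs ≡ 0) →
               IsDyckPath n d →
               hits (sole X Y) (toList d) ≤ hits (sole Y X) (toList d) ⊎ ℕΣ.sumBy vℕ (toList d) < M μ d
      sole-slack {X} {Y} {d} antiX adj node noY dyck with hits≡0⊎∈ (sole X Y) (toList d)
      ... | inj₁ none = inj₁ (m≡0⇒m≤n none)
      ... | inj₂ (a , a∈ , a∈sole) with sole-partner {X} {Y} antiX adj (dyck-chain dyck) a∈ a∈sole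
      ...   | inj₁ hit  = inj₁ (ℕP.≤-trans (hits≤1 (sole-antichain {X} {Y} antiX) (dyck-chain dyck)) hit)
      ...   | inj₂ none = let (a∈X , _ , unreached) = sole⁻ {X} {Y} a∈sole in
                          inj₂ (vℕ<M dyck a∈ (node a∈X) unreached (noY {toList d} none))

      -- v + χ_{S⁺} - χ_{S⁻}; the truncated subtraction is exact wherever ind S⁻ p ≤ vℕ p.
      perturb : Subset → Subset → Pair → ℕ
      perturb S⁺ S⁻ p = vℕ p ℕ.+ ind S⁺ p ∸ ind S⁻ p

      perturb-+ : ∀ S⁺ S⁻ p → ind S⁻ p ≤ vℕ p → perturb S⁺ S⁻ p ℕ.+ ind S⁻ p ≡ vℕ p ℕ.+ ind S⁺ p
      perturb-+ S⁺ S⁻ p S⁻≤v = ℕP.m∸n+n≡m (ℕP.≤-trans S⁻≤v (ℕP.m≤m+n (vℕ p) (ind S⁺ p)))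

      perturb-bound : ∀ {S⁺ S⁻} → IsAntichain S⁺ → (∀ p → ind S⁻ p ≤ vℕ p) →
                      (∀ {d} → IsDyckPath n d →
                         hits S⁺ (toList d) ≤ hits S⁻ (toList d) ⊎ ℕΣ.sumBy vℕ (toList d) < M μ d) →
                      ∀ d → IsDyckPath n d → ℕΣ.sumBy (perturb S⁺ S⁻) (toList d) ≤ M μ d
      perturb-bound {S⁺} {S⁻} anti S⁻≤v slack d dyck =
        shift-≤ sums (hits≤1 anti (dyck-chain dyck)) (v-bound d dyck) (slack dyck)
        where
        xs = toList d
        sums : ℕΣ.sumBy (perturb S⁺ S⁻) xs ℕ.+ hits S⁻ xs ≡ ℕΣ.sumBy vℕ xs ℕ.+ hits S⁺ xs
        sums = trans (sym (ℕΣ.sumBy-+ (perturb S⁺ S⁻) (ind S⁻) xs))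
                 (trans (ℕΣ.sumBy-cong {xs = xs} (λ {p} _ → perturb-+ S⁺ S⁻ p (S⁻≤v p)))
                        (ℕΣ.sumBy-+ vℕ (ind S⁺) xs))

      ind-A≤vℕ : ∀ p → ind A p ≤ vℕ p
      ind-A≤vℕ p = ℕP.≤-trans (ℕP.≤-reflexive (sym (ℕP.*-identityˡ (ind A p))))
                   (ℕP.≤-trans (ℕP.*-monoˡ-≤ (ind A p) 1≤ai) (ℕP.m≤m+n (ai ℕ.* ind A p) (ai1 ℕ.* ind B p)))

      ind-B≤vℕ : ∀ p → ind B p ≤ vℕ p
      ind-B≤vℕ p = ℕP.≤-trans (ℕP.≤-reflexive (sym (ℕP.*-identityˡ (ind B p))))
                   (ℕP.≤-trans (ℕP.*-monoˡ-≤ (ind B p) 1≤ai1) (ℕP.m≤n+m (ai1 ℕ.* ind B p) (ai ℕ.* ind A p)))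

      ind-sole≤vℕ : ∀ {X Y} → (∀ p → ind X p ≤ vℕ p) → ∀ p → ind (sole X Y) p ≤ vℕ p
      ind-sole≤vℕ {X} {Y} X≤v p =
        ℕP.≤-trans (ind-∖≤ {X ∖ Y} {Reached} p) (ℕP.≤-trans (ind-∖≤ {X} {Y} p) (X≤v p))

      sole-separates : ∀ {X Y p} → (∀ p → ind X p ≤ vℕ p) → p ∈S sole X Y →
                       perturb (sole X Y) (sole Y X) p ≢ perturb (sole Y X) (sole X Y) p
      sole-separates {X} {Y} {p} X≤v p∈ = shifts-differ
        (subst₂ (λ b a → perturb (sole X Y) (sole Y X) p ℕ.+ b ≡ vℕ p ℕ.+ a) off on
          (perturb-+ (sole X Y) (sole Y X) p (subst (_≤ vℕ p) (sym off) z≤n)))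
        (subst₂ (λ b a → perturb (sole Y X) (sole X Y) p ℕ.+ b ≡ vℕ p ℕ.+ a) on off
          (perturb-+ (sole Y X) (sole X Y) p (ind-sole≤vℕ {X} {Y} X≤v p)))
        where
        on : ind (sole X Y) p ≡ 1
        on = ind-∈ {sole X Y} p∈
        off : ind (sole Y X) p ≡ 0
        off = ind-∉ {sole Y X} p λ p∈′ → proj₁ (proj₂ (sole⁻ {X} {Y} p∈)) (proj₁ (sole⁻ {Y} {X} p∈′))

      y z : Pair → ℕ
      y = perturb (sole A B) (sole B A)
      z = perturb (sole B A) (sole A B)

      pointℕ : (Pair → ℕ) → Point
      pointℕ f k l = ℕ→ℚ (f (k , l))

      y∈P : InP n μ (pointℕ y)
      y∈P = ℕ-point-InP {b = μ} (pointℕ y) y (λ _ _ → refl)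
        (perturb-bound (sole-antichain {A} {B} antiA) (ind-sole≤vℕ {B} {A} ind-B≤vℕ)
          (sole-slack {A} {B} antiA (λ p∈A q∈B p≢q p~q → inj₁ p∈A , inj₂ q∈B , p≢q , p~q) inj₁ inj₂))

      z∈P : InP n μ (pointℕ z)
      z∈P = ℕ-point-InP {b = μ} (pointℕ z) z (λ _ _ → refl)
        (perturb-bound (sole-antichain {B} {A} antiB) (ind-sole≤vℕ {A} {B} ind-A≤vℕ)
          (sole-slack {B} {A} antiB (λ p∈B q∈A p≢q p~q → inj₂ p∈B , inj₁ q∈A , p≢q , p~q) inj₂ inj₁))

      v-midpoint : (v ≈U (λ k l → ℚ.½ ℚ.* pointℕ y k l ℚ.+ (1ℚ ℚ.- ℚ.½) ℚ.* pointℕ z k l)) n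
      v-midpoint k l _ = trans (v≡vℕ k l) (ℕ→ℚ-midpoint {y (k , l)} {z (k , l)} {vℕ (k , l)}
        (shifts-average {y (k , l)} {z (k , l)} {vℕ (k , l)} {ind (sole A B) (k , l)} {ind (sole B A) (k , l)}
        (perturb-+ (sole A B) (sole B A) (k , l) (ind-sole≤vℕ {B} {A} ind-B≤vℕ (k , l)))
        (perturb-+ (sole B A) (sole A B) (k , l) (ind-sole≤vℕ {A} {B} ind-A≤vℕ (k , l)))))

      perturbations-agree : IsVertex n μ v → ∀ {p} → Node A B p → y p ≡ z p
      perturbations-agree (_ , extreme) {p} node = ℕ→ℚ-injective {y p} {z p}
        (extreme (pointℕ y) (pointℕ z) ℚ.½ y∈P z∈P 0<½ ½<1 v-midpoint (proj₁ p) (proj₂ p) (node-valid node))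
        where
        0<½ : 0ℚ ℚ.< ℚ.½
        0<½ = ℚ.*<* (ℤ.+<+ (s≤s z≤n))
        ½<1 : ℚ.½ ℚ.< 1ℚ
        ½<1 = ℚ.*<* (ℤ.+<+ (s≤s (s≤s z≤n)))

      vertex⇒ : IsVertex n μ v → Condition
      vertex⇒ vertex p node = classify (p ∈S? A) (p ∈S? B) (p ∈S? Reached)
        where
        classify : Dec (p ∈S A) → Dec (p ∈S B) → Dec (p ∈S Reached) →
                   (p ∈S A × p ∈S B) ⊎ InΔ n i A B p
        classify (yes p∈A) (yes p∈B) _             = inj₁ (p∈A , p∈B)
        classify _         _         (yes reached) = inj₂ (sound (reached⇒∈ reached))
        classify (yes p∈A) (no p∉B)  (no unreached) =
          ⊥-elim (sole-separates {A} {B} ind-A≤vℕ (sole⁺ {A} {B} p∈A p∉B unreached)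
                                 (perturbations-agree vertex node))
        classify (no p∉A)  (yes p∈B) (no unreached) =
          ⊥-elim (sole-separates {B} {A} ind-B≤vℕ (sole⁺ {B} {A} p∈B p∉A unreached)
                                 (sym (perturbations-agree vertex node)))
        classify (no p∉A)  (no p∉B)  _             = ⊥-elim ([ p∉A , p∉B ]′ node)

    vertex⇒ : IsVertex n μ v → Condition
    vertex⇒ = Perturbation.vertex⇒ (saturate (filter out? (pairsUpTo n)) seeds-in-Δ)

open import Data.Rational using (_+_; _*_)

proposition2p2 : (n i ai ai1 : ℕ) → 3 ≤ n → 1 ≤ i → i ≤ n ∸ 2 → 1 ≤ ai → 1 ≤ ai1 →
    (Ai Ai1 : Subset) →
    SubsetOfQ n i Ai → IsAntichain Ai →
    SubsetOfQ n (suc i) Ai1 → IsAntichain Ai1 →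
    IsVertex n (twoWeight i ai ai1)
      (λ k l → ℕ→ℚ ai * χ Ai k l + ℕ→ℚ ai1 * χ Ai1 k l)
    ⇔ (∀ p → Node Ai Ai1 p → ((p ∈S Ai) × (p ∈S Ai1)) ⊎ InΔ n i Ai Ai1 p)
proposition2p2 n i ai ai1 _ _ _ 1≤ai 1≤ai1 A B A⊆Qi antiA B⊆Qi+1 antiB =
  mk⇔ (Forward.vertex⇒ 1≤ai 1≤ai1) vertex⇐
  where open Vertex n i ai ai1 A B A⊆Qi antiA B⊆Qi+1 antiB
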